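{- Let $n \ge 2$ be an integer and let $G = G_{2^n+1,2}$. For a vertex $v \in V(G)$, we have $\chi(G - v) < \chi(G)$ if and only if $v \in W$, where \[ W = \{(x,y) : 1 \le x < y \le 2^n+1 \text{ and } \{x,y\} \subseteq I_\ell \text{ for some } \ell \in \{0,1,\dots,n\}\}, \] and $I_\ell = [\,2^\ell,\; 2^n - 2^{n-\ell} + 2\,]$ for $0 \le \ell \le n$.
   Context: For integers $p \le q$, $[p,q]$ denotes $\{p,p+1,\dots,q\}$. For an integer $N \ge 5$, the shift graph $G_{N,2}$ has as vertices the ordered pairs $(x,y)$ of integers with $1 \le x < y \le N$, and two vertices $(x,y)$ and $(y,z)$ are adjacent whenever $x<y<z$ (these are the only edges). $G - v$ denotes the graph obtained by deleting the vertex $v$. -}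

module Defs where

open import Data.Nat using (ℕ; _+_; _∸_; _^_; _≤_; _<_)
open import Data.Fin using (Fin)
open import Data.Product using (Σ; _×_; _,_; proj₁; proj₂; ∃-syntax)
open import Data.Sum using (_⊎_)
open import Relation.Binary.PropositionalEquality using (_≡_; _≢_)

record Graph : Set₁ where
  field
    V : Set
    E : V → V → Set
open Graph public

Colourable : Graph → ℕ → Set
Colourable G k = Σ (V G → Fin k) λ c → ∀ u w → E G u w → c u ≢ c w

IsChromaticNumber : Graph → ℕ → Set
IsChromaticNumber G k = Colourable G k × (∀ j → Colourable G j → k ≤ j)

_─_ : (G : Graph) → V G → Graph
G ─ v = record { V = Σ (V G) λ u → u ≢ v ; E = λ u w → E G (proj₁ u) (proj₁ w) }

ShiftV : ℕ → Set
ShiftV N = Σ (ℕ × ℕ) λ p → 1 ≤ proj₁ p × proj₁ p < proj₂ p × proj₂ p ≤ N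

ShiftE : (N : ℕ) → ShiftV N → ShiftV N → Set
ShiftE N ((x , y) , _) ((x' , y') , _) = (y ≡ x') ⊎ (y' ≡ x)

ShiftGraph : ℕ → Graph
ShiftGraph N = record { V = ShiftV N ; E = ShiftE N }

ChiLess : Graph → Graph → Set
ChiLess H G = ∀ a b → IsChromaticNumber G a → IsChromaticNumber H b → b < a

InI : ℕ → ℕ → ℕ → Set
InI n ℓ z = 2 ^ ℓ ≤ z × z ≤ (2 ^ n ∸ 2 ^ (n ∸ ℓ)) + 2

InW : (n : ℕ) → ShiftV (2 ^ n + 1) → Set
InW n ((x , y) , _) = ∃[ ℓ ] (ℓ ≤ n × InI n ℓ x × InI n ℓ y)

{-# OPTIONS --safe #-}
module Submission where

-- A proper k-colouring of G_{N,2}, or of G_{N,2} minus a vertex, amounts to subsets S 1, …, S N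
-- of Fin k with S x ⊈ S y for every remaining vertex (x , y): colour (x , y) by an element of
-- S x ─ S y, and conversely let S x be the set of colours of the vertices (x , _).  For
-- N = 2ⁿ + 1 and k = n these subsets cannot all be distinct, so if (a , b) is the missing
-- vertex then S a = S b = T.  The S x with a < x are pairwise distinct and only S b contains T,
-- so counting the subsets not containing T gives 2^(n ∸ ∣T∣) ≤ a; dually b ≤ 2ⁿ ∸ 2^∣T∣ + 2,
-- i.e. (a , b) ∈ W with ℓ = n ∸ ∣T∣.  Conversely, for ∣T∣ = n ∸ ℓ list the strict supersets of
-- T, then the subsets incomparable with T with T among them, then the strict subsets of T,
-- never a subset before one of its supersets; inserting a second copy of T at position a gives
-- the family for G_{N,2} − (a , b).  As (1 , 2ⁿ + 1) ∉ W, not even G_{N,2} − (1 , 2ⁿ + 1) is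
-- n-colourable, while 2ⁿ⁺¹ ≥ N subsets give an (n + 1)-colouring of G_{N,2}; so χ(G) = n + 1.

open import Defs
open import Data.Nat using (ℕ; zero; suc; _+_; _∸_; _^_; _≤_; _<_; z≤n; s≤s; s≤s⁻¹; _≟_; _≤?_; _<?_)
open import Data.Nat.Properties
open import Data.Nat.Tactic.RingSolver using (solve-∀)
open import Data.Bool using (true; false)
import Data.Bool as Bool
open import Data.Fin using (Fin; zero; suc; toℕ; fromℕ<; inject≤)
import Data.Fin as Fin
open import Data.Fin.Properties using (injective⇒≤; any?; toℕ-fromℕ<; toℕ-inject≤; toℕ-injective)
open import Data.Fin.Subset
  using (Subset; inside; outside; _⊆_; _⊈_; ∣_∣)
  renaming (_∈_ to _∈ₛ_; _∉_ to _∉ₛ_; ⊥ to ∅)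
open import Data.Fin.Subset.Properties
  using (_⊆?_; _∈?_; ⊆-refl; ⊆-reflexive; ⊆-trans; ⊆-antisym; drop-∷-⊆; in⊆in-⇔; out⊆-⇔; ∣p∣≤n; ∣⊥∣≡0)
open import Data.Vec using ([]; _∷_; here; there; tabulate)
open import Data.Vec.Properties using (lookup∘tabulate; lookup⇒[]=; []=⇒lookup)
import Data.Vec.Properties as Vec
open import Data.List using (List; []; _∷_; _++_; map; filter; length; lookup; applyUpTo; take; drop)
open import Data.List.Properties
  using (length-++; length-map; length-applyUpTo; length-take; take++drop≡id; filter-++; filter-≐; filter-none)
open import Data.List.Membership.Propositional using (_∈_)
open import Data.List.Membership.Propositional.Properties
  using (∈-lookup; ∈-++⁺ˡ; ∈-++⁺ʳ; ∈-++⁻; ∈-map⁺; ∈-applyUpTo⁻; ∈-filter⁺)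
open import Data.List.Relation.Binary.Subset.Propositional using () renaming (_⊆_ to _⊆ₗ_)
open import Data.List.Relation.Unary.All as All using (All; []; _∷_)
import Data.List.Relation.Unary.All.Properties as All
open import Data.List.Relation.Unary.Any using (here; there; index)
open import Data.List.Relation.Unary.Any.Properties using (lookup-index)
open import Data.List.Relation.Unary.AllPairs as AllPairs using (AllPairs; []; _∷_)
import Data.List.Relation.Unary.AllPairs.Properties as AllPairs
open import Data.List.Relation.Unary.Unique.Propositional using (Unique)
open import Data.Maybe using (Maybe; just; nothing)
open import Data.Maybe.Relation.Unary.Any as MaybeAny using () renaming (Any to AnyMaybe)
open import Data.Product using (∃₂; ∃-syntax; _×_; _,_; proj₁; proj₂)
import Data.Product.Properties as Product
open import Data.Sum using (inj₁; inj₂)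
open import Function using (_∘_)
open import Function.Bundles using (_⇔_; mk⇔; Equivalence)
open import Level using (Level)
open import Relation.Binary.Definitions using (tri<; tri≈; tri>)
open import Relation.Binary.PropositionalEquality
open import Relation.Nullary using (¬_; Dec; does; yes; no; contradiction; ¬?; _×-dec_)
open import Relation.Nullary.Decidable using (dec-true; dec-false; decidable-stable; map′)
open import Relation.Unary using (Pred; Decidable; _≐_)
open import Relation.Unary.Properties using (∁?)

private
  variable
    ℓ₁ ℓ₂ : Level
    A : Set ℓ₁
    k n : ℕ

lookup-injective : {xs : List A} → Unique xs → ∀ {i j} → lookup xs i ≡ lookup xs j → i ≡ j
lookup-injective (x≢ ∷ u) {zero}  {zero}  _  = refl
lookup-injective (x≢ ∷ u) {zero}  {suc j} eq = contradiction eq (All.lookup x≢ (∈-lookup j))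
lookup-injective (x≢ ∷ u) {suc i} {zero}  eq = contradiction (sym eq) (All.lookup x≢ (∈-lookup i))
lookup-injective (_ ∷ u)  {suc i} {suc j} eq = cong suc (lookup-injective u eq)

Unique-⊆⇒length≤ : {xs ys : List A} → Unique xs → xs ⊆ₗ ys → length xs ≤ length ys
Unique-⊆⇒length≤ {xs = xs} {ys} uniq xs⊆ys = injective⇒≤ {f = position} position-injective
  where
  position : Fin (length xs) → Fin (length ys)
  position i = index (xs⊆ys (∈-lookup i))
  position-injective : ∀ {i j} → position i ≡ position j → i ≡ j
  position-injective {i} {j} eq = lookup-injective uniq (begin
    lookup xs i                  ≡⟨ lookup-index (xs⊆ys (∈-lookup i)) ⟩
    lookup ys (position i)       ≡⟨ cong (lookup ys) eq ⟩
    lookup ys (position j)       ≡⟨ lookup-index (xs⊆ys (∈-lookup j)) ⟨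
    lookup xs j                  ∎)
    where open ≡-Reasoning

interval-pigeonhole : (f : ℕ → A) (lo m : ℕ) {ys : List A} →
  (∀ {x y} → lo ≤ x → x < y → y < lo + m → f x ≢ f y) →
  (∀ {x} → lo ≤ x → x < lo + m → f x ∈ ys) →
  m ≤ length ys
interval-pigeonhole f lo m {ys} distinct into = begin
  m                                 ≡⟨ length-applyUpTo (f ∘ (lo +_)) m ⟨
  length (applyUpTo (f ∘ (lo +_)) m) ≤⟨ Unique-⊆⇒length≤ unique covered ⟩
  length ys                         ∎
  where
  open ≤-Reasoning
  unique : Unique (applyUpTo (f ∘ (lo +_)) m)
  unique = AllPairs.applyUpTo⁺₁ (f ∘ (lo +_)) m
    (λ i<j j<m → distinct (m≤m+n lo _) (+-monoʳ-< lo i<j) (+-monoʳ-< lo j<m))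
  covered : applyUpTo (f ∘ (lo +_)) m ⊆ₗ ys
  covered x∈ with i , i<m , refl ← ∈-applyUpTo⁻ (f ∘ (lo +_)) x∈ = into (m≤m+n lo i) (+-monoʳ-< lo i<m)

module _ {R : A → A → Set ℓ₂} where

  AllPairs-insert : ∀ xs {ys t} → AllPairs R (xs ++ ys) → All (λ x → R x t) xs → All (R t) ys →
    AllPairs R (xs ++ t ∷ ys)
  AllPairs-insert []       sorted         []           t≺ys = t≺ys ∷ sorted
  AllPairs-insert (x ∷ xs) (x≺ ∷ sorted) (x≺t ∷ xs≺t) t≺ys =
    All.++⁺ (All.++⁻ˡ xs x≺) (x≺t ∷ All.++⁻ʳ xs x≺) ∷ AllPairs-insert xs sorted xs≺t t≺ys

module _ {P : Pred A ℓ₂} (P? : Decidable P) where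

  length-filter-map : {B : Set ℓ₁} (f : B → A) (xs : List B) →
    length (filter P? (map f xs)) ≡ length (filter (P? ∘ f) xs)
  length-filter-map f []       = refl
  length-filter-map f (x ∷ xs) with does (P? (f x))
  ... | true  = cong suc (length-filter-map f xs)
  ... | false = length-filter-map f xs

  length-filter+filter-∁ : ∀ xs → length (filter P? xs) + length (filter (∁? P?) xs) ≡ length xs
  length-filter+filter-∁ []       = refl
  length-filter+filter-∁ (x ∷ xs) with P? x
  ... | yes _ = cong suc (length-filter+filter-∁ xs)
  ... | no  _ = trans (+-suc _ _) (cong suc (length-filter+filter-∁ xs))

⊈⇒∃∈∉ : {p q : Subset n} → p ⊈ q → ∃[ i ] (i ∈ₛ p × i ∉ₛ q)
⊈⇒∃∈∉ {p = p} {q} p⊈q with any? (λ i → i ∈? p ×-dec ¬? (i ∈? q))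
... | yes witness = witness
... | no none     =
  contradiction (λ {i} i∈p → decidable-stable (i ∈? q) (λ i∉q → none (i , i∈p , i∉q))) p⊈q

comprehension : {P : Pred (Fin n) ℓ₂} → Decidable P → Subset n
comprehension P? = tabulate (does ∘ P?)

module _ {P : Pred (Fin n) ℓ₂} (P? : Decidable P) {i : Fin n} where

  ∈-comprehension⁺ : P i → i ∈ₛ comprehension P?
  ∈-comprehension⁺ Pi = lookup⇒[]= i _ (trans (lookup∘tabulate (does ∘ P?) i) (dec-true (P? i) Pi))

  ∈-comprehension⁻ : i ∈ₛ comprehension P? → P i
  ∈-comprehension⁻ i∈ = decidable-stable (P? i) λ ¬Pi → contradiction
    (trans (sym (dec-false (P? i) ¬Pi)) (trans (sym (lookup∘tabulate (does ∘ P?) i)) ([]=⇒lookup i∈)))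
    λ ()

firsts : ℕ → (n : ℕ) → Subset n
firsts zero    n       = ∅
firsts (suc k) zero    = []
firsts (suc k) (suc n) = inside ∷ firsts k n

∣firsts∣ : ∀ {k n} → k ≤ n → ∣ firsts k n ∣ ≡ k
∣firsts∣ {zero}  {n}     _         = ∣⊥∣≡0 n
∣firsts∣ {suc k} {suc n} (s≤s k≤n) = cong suc (∣firsts∣ k≤n)

subsets : ∀ n → List (Subset n)
subsets zero    = [] ∷ []
subsets (suc n) = map (inside ∷_) (subsets n) ++ map (outside ∷_) (subsets n)

∈-subsets : (p : Subset n) → p ∈ subsets n
∈-subsets []            = here refl
∈-subsets (inside ∷ p)  = ∈-++⁺ˡ (∈-map⁺ (inside ∷_) (∈-subsets p))
∈-subsets (outside ∷ p) = ∈-++⁺ʳ (map (inside ∷_) (subsets _)) (∈-map⁺ (outside ∷_) (∈-subsets p))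

length-subsets : ∀ n → length (subsets n) ≡ 2 ^ n
length-subsets zero    = refl
length-subsets (suc n) = begin
  length (map (inside ∷_) (subsets n) ++ map (outside ∷_) (subsets n))
    ≡⟨ length-++ (map (inside ∷_) (subsets n)) ⟩
  length (map (inside ∷_) (subsets n)) + length (map (outside ∷_) (subsets n))
    ≡⟨ cong₂ _+_ (length-map (inside ∷_) (subsets n)) (length-map (outside ∷_) (subsets n)) ⟩
  length (subsets n) + length (subsets n)
    ≡⟨ cong (λ m → m + m) (length-subsets n) ⟩
  2 ^ n + 2 ^ n
    ≡⟨ cong (2 ^ n +_) (+-identityʳ (2 ^ n)) ⟨
  2 ^ suc n ∎
  where open ≡-Reasoning

inside∷⊈outside∷ : {p q : Subset n} → inside ∷ p ⊈ outside ∷ q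
inside∷⊈outside∷ inside∷p⊆outside∷q with () ← inside∷p⊆outside∷q here

subsets-sorted : ∀ n → AllPairs _⊈_ (subsets n)
subsets-sorted zero    = [] ∷ []
subsets-sorted (suc n) = AllPairs.++⁺ (extend inside) (extend outside)
  (All.map⁺ (All.universal (λ _ → All.map⁺ (All.universal (λ _ → inside∷⊈outside∷) (subsets n)))
                           (subsets n)))
  where
  extend : ∀ s → AllPairs _⊈_ (map (s ∷_) (subsets n))
  extend s = AllPairs.map⁺ (AllPairs.map (_∘ drop-∷-⊆) (subsets-sorted n))

filter-subsets-sorted : {P : Pred (Subset n) ℓ₂} (P? : Decidable P) → AllPairs _⊈_ (filter P? (subsets n))
filter-subsets-sorted P? = AllPairs.filter⁺ P? (subsets-sorted _)

count : {P : Pred (Subset n) ℓ₂} → Decidable P → ℕ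
count P? = length (filter P? (subsets _))

count-∁ : {P : Pred (Subset n) ℓ₂} (P? : Decidable P) → count P? + count (∁? P?) ≡ 2 ^ n
count-∁ {n} P? = trans (length-filter+filter-∁ P? (subsets n)) (length-subsets n)

count-∷ : {P : Pred (Subset (suc n)) ℓ₂} (P? : Decidable P) →
  count P? ≡ count (λ q → P? (inside ∷ q)) + count (λ q → P? (outside ∷ q))
count-∷ {n} P? = begin
  length (filter P? (map (inside ∷_) (subsets n) ++ map (outside ∷_) (subsets n)))
    ≡⟨ cong length (filter-++ P? (map (inside ∷_) (subsets n)) _) ⟩
  length (filter P? (map (inside ∷_) (subsets n)) ++ filter P? (map (outside ∷_) (subsets n)))
    ≡⟨ length-++ (filter P? (map (inside ∷_) (subsets n))) ⟩
  length (filter P? (map (inside ∷_) (subsets n))) + length (filter P? (map (outside ∷_) (subsets n)))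
    ≡⟨ cong₂ _+_ (length-filter-map P? (λ (q : Subset n) → inside ∷ q) (subsets n))
                 (length-filter-map P? (λ (q : Subset n) → outside ∷ q) (subsets n)) ⟩
  count (λ q → P? (inside ∷ q)) + count (λ q → P? (outside ∷ q)) ∎
  where open ≡-Reasoning

count-≐ : {P Q : Pred (Subset n) ℓ₂} (P? : Decidable P) (Q? : Decidable Q) → P ≐ Q → count P? ≡ count Q?
count-≐ P? Q? P≐Q = cong length (filter-≐ P? Q? P≐Q (subsets _))

count-∅ : {P : Pred (Subset n) ℓ₂} (P? : Decidable P) → (∀ q → ¬ P q) → count P? ≡ 0
count-∅ P? ¬P = cong length (filter-none P? (All.universal ¬P (subsets _)))

count-⊇ : (p : Subset n) → count (p ⊆?_) ≡ 2 ^ (n ∸ ∣ p ∣)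
count-⊇ []            = refl
count-⊇ {suc n} (inside ∷ p) = begin
  count ((inside ∷ p) ⊆?_)
    ≡⟨ count-∷ ((inside ∷ p) ⊆?_) ⟩
  count (λ q → (inside ∷ p) ⊆? (inside ∷ q)) + count (λ q → (inside ∷ p) ⊆? (outside ∷ q))
    ≡⟨ cong₂ _+_ (count-≐ _ (p ⊆?_) (from in⊆in-⇔ , to in⊆in-⇔))
                 (count-∅ (λ q → (inside ∷ p) ⊆? (outside ∷ q)) (λ _ → inside∷⊈outside∷)) ⟩
  count (p ⊆?_) + 0
    ≡⟨ +-identityʳ _ ⟩
  count (p ⊆?_)
    ≡⟨ count-⊇ p ⟩
  2 ^ (suc n ∸ ∣ inside ∷ p ∣) ∎
  where open ≡-Reasoning; open Equivalence
count-⊇ {suc n} (outside ∷ p) = begin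
  count ((outside ∷ p) ⊆?_)
    ≡⟨ count-∷ ((outside ∷ p) ⊆?_) ⟩
  count (λ q → (outside ∷ p) ⊆? (inside ∷ q)) + count (λ q → (outside ∷ p) ⊆? (outside ∷ q))
    ≡⟨ cong₂ _+_ (count-≐ _ (p ⊆?_) (from out⊆-⇔ , to out⊆-⇔))
                 (count-≐ _ (p ⊆?_) (from out⊆-⇔ , to out⊆-⇔)) ⟩
  count (p ⊆?_) + count (p ⊆?_)
    ≡⟨ cong (λ m → m + m) (count-⊇ p) ⟩
  2 ^ (n ∸ ∣ p ∣) + 2 ^ (n ∸ ∣ p ∣)
    ≡⟨ cong (2 ^ (n ∸ ∣ p ∣) +_) (+-identityʳ _) ⟨
  2 ^ suc (n ∸ ∣ p ∣)
    ≡⟨ cong (2 ^_) (+-∸-assoc 1 (∣p∣≤n p)) ⟨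
  2 ^ (suc n ∸ ∣ outside ∷ p ∣) ∎
  where open ≡-Reasoning; open Equivalence

count-⊆ : (p : Subset n) → count (_⊆? p) ≡ 2 ^ ∣ p ∣
count-⊆ []            = refl
count-⊆ (inside ∷ p)  = begin
  count (_⊆? (inside ∷ p))
    ≡⟨ count-∷ (_⊆? (inside ∷ p)) ⟩
  count (λ q → (inside ∷ q) ⊆? (inside ∷ p)) + count (λ q → (outside ∷ q) ⊆? (inside ∷ p))
    ≡⟨ cong₂ _+_ (count-≐ _ (_⊆? p) (from in⊆in-⇔ , to in⊆in-⇔))
                 (count-≐ _ (_⊆? p) (from out⊆-⇔ , to out⊆-⇔)) ⟩
  count (_⊆? p) + count (_⊆? p)
    ≡⟨ cong (λ m → m + m) (count-⊆ p) ⟩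
  2 ^ ∣ p ∣ + 2 ^ ∣ p ∣
    ≡⟨ cong (2 ^ ∣ p ∣ +_) (+-identityʳ _) ⟨
  2 ^ ∣ inside ∷ p ∣ ∎
  where open ≡-Reasoning; open Equivalence
count-⊆ (outside ∷ p) = begin
  count (_⊆? (outside ∷ p))
    ≡⟨ count-∷ (_⊆? (outside ∷ p)) ⟩
  count (λ q → (inside ∷ q) ⊆? (outside ∷ p)) + count (λ q → (outside ∷ q) ⊆? (outside ∷ p))
    ≡⟨ cong₂ _+_ (count-∅ (λ q → (inside ∷ q) ⊆? (outside ∷ p)) (λ _ → inside∷⊈outside∷))
                 (count-≐ _ (_⊆? p) (from out⊆-⇔ , to out⊆-⇔)) ⟩
  count (_⊆? p)
    ≡⟨ count-⊆ p ⟩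
  2 ^ ∣ outside ∷ p ∣ ∎
  where open ≡-Reasoning; open Equivalence

sorted⇒unique : {xs : List (Subset n)} → AllPairs _⊈_ xs → Unique xs
sorted⇒unique = AllPairs.map (λ p⊈q p≡q → p⊈q (⊆-reflexive p≡q))

sorted-length≤count : {P : Pred (Subset n) ℓ₂} (P? : Decidable P) {xs : List (Subset n)} →
  AllPairs _⊈_ xs → All P xs → length xs ≤ count P?
sorted-length≤count P? sorted all-P = Unique-⊆⇒length≤ (sorted⇒unique sorted)
  (λ x∈xs → ∈-filter⁺ P? (∈-subsets _) (All.lookup all-P x∈xs))

_‼_ : List (Subset n) → ℕ → Subset n
[]       ‼ _     = ∅
(x ∷ xs) ‼ zero  = x
(x ∷ xs) ‼ suc i = xs ‼ i

‼-++ʳ : ∀ (xs : List (Subset n)) {ys} j → (xs ++ ys) ‼ (length xs + j) ≡ ys ‼ j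
‼-++ʳ []       j = refl
‼-++ʳ (x ∷ xs) j = ‼-++ʳ xs j

‼-++ˡ : ∀ (xs : List (Subset n)) {ys j} → j < length xs → (xs ++ ys) ‼ j ≡ xs ‼ j
‼-++ˡ (x ∷ xs) {j = zero}  _         = refl
‼-++ˡ (x ∷ xs) {j = suc j} (s≤s j<) = ‼-++ˡ xs j<

All-‼ : {P : Pred (Subset n) ℓ₂} {xs : List (Subset n)} → All P xs → ∀ {j} → j < length xs → P (xs ‼ j)
All-‼ (px ∷ _)   {zero}  _         = px
All-‼ (_ ∷ pxs) {suc j} (s≤s j<) = All-‼ pxs j<

AllPairs-‼ : {R : Subset n → Subset n → Set ℓ₂} {xs : List (Subset n)} → AllPairs R xs →
  ∀ {i j} → i < j → j < length xs → R (xs ‼ i) (xs ‼ j)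
AllPairs-‼ (x≺ ∷ _)      {zero}  {suc j} _         (s≤s j<) = All-‼ x≺ j<
AllPairs-‼ (_ ∷ sorted) {suc i} {suc j} (s≤s i<j) (s≤s j<) = AllPairs-‼ sorted i<j j<

colourable-≤ : ∀ {G j k} → j ≤ k → Colourable G j → Colourable G k
colourable-≤ j≤k (c , proper) = (λ u → inject≤ (c u) j≤k) ,
  λ u w uw same → proper u w uw (toℕ-injective (begin
    toℕ (c u)              ≡⟨ toℕ-inject≤ (c u) j≤k ⟨
    toℕ (inject≤ (c u) j≤k) ≡⟨ cong toℕ same ⟩
    toℕ (inject≤ (c w) j≤k) ≡⟨ toℕ-inject≤ (c w) j≤k ⟩
    toℕ (c w)              ∎))
  where open ≡-Reasoning

colourable-─ : ∀ {G k} (v : V G) → Colourable G k → Colourable (G ─ v) k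
colourable-─ v (c , proper) = c ∘ proj₁ , λ u w → proper (proj₁ u) (proj₁ w)

chromatic : ∀ {G n} → ¬ Colourable G n → Colourable G (suc n) → IsChromaticNumber G (suc n)
chromatic ¬colourable colourable =
  colourable , λ j colourable-j → ≰⇒> λ j≤n → ¬colourable (colourable-≤ j≤n colourable-j)

module _ {N : ℕ} where

  tail head : ShiftV N → ℕ
  tail u = proj₁ (proj₁ u)
  head u = proj₂ (proj₁ u)

  Separates : (ℕ → Subset k) → ShiftV N → Set
  Separates S u = S (tail u) ⊈ S (head u)

  SeparatesAllBut : (ℕ → Subset k) → ShiftV N → Set
  SeparatesAllBut S v = ∀ u → proj₁ u ≢ proj₁ v → Separates S u

  separating⇒colourable : (G : Graph) (ι : V G → ShiftV N) → (∀ u w → E G u w → ShiftE N (ι u) (ι w)) →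
    (S : ℕ → Subset k) → (∀ u → Separates S (ι u)) → Colourable G k
  separating⇒colourable {k = k} G ι hom S separates = colour , proper
    where
    colour : V G → Fin k
    colour u = proj₁ (⊈⇒∃∈∉ (separates u))
    colour∈ : ∀ u → colour u ∈ₛ S (tail (ι u))
    colour∈ u = proj₁ (proj₂ (⊈⇒∃∈∉ (separates u)))
    colour∉ : ∀ u → colour u ∉ₛ S (head (ι u))
    colour∉ u = proj₂ (proj₂ (⊈⇒∃∈∉ (separates u)))
    chained : ∀ u w → head (ι u) ≡ tail (ι w) → colour u ≢ colour w
    chained u w head≡tail same = colour∉ u (subst₂ (λ i x → i ∈ₛ S x) (sym same) (sym head≡tail) (colour∈ w))
    proper : ∀ u w → E G u w → colour u ≢ colour w
    proper u w uw with hom u w uw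
    ... | inj₁ head≡tail = chained u w head≡tail
    ... | inj₂ head≡tail = chained w u head≡tail ∘ sym

  colourable⇒separating : (v : ShiftV N) → Colourable (ShiftGraph N ─ v) k → ∃[ S ] SeparatesAllBut {k = k} S v
  colourable⇒separating {k = k} v (c , proper) = colours , separates
    where
    -- Vertices differing only in the proof of ≢ v may get different colours, so the colours
    -- of x are read off one canonical vertex per pair.
    vertexAt : ℕ → ℕ → Maybe (V (ShiftGraph N ─ v))
    vertexAt x y with 1 ≤? x ×-dec x <? y ×-dec y ≤? N | Product.≡-dec _≟_ _≟_ (x , y) (proj₁ v)
    ... | yes edge | no ≢v = just (((x , y) , edge) , ≢v ∘ cong proj₁)
    ... | _        | _     = nothing

    vertexAt-ends : ∀ x y {w} → vertexAt x y ≡ just w → proj₁ (proj₁ w) ≡ (x , y)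
    vertexAt-ends x y eq with 1 ≤? x ×-dec x <? y ×-dec y ≤? N | Product.≡-dec _≟_ _≟_ (x , y) (proj₁ v)
    vertexAt-ends x y refl | yes _ | no _  = refl
    vertexAt-ends x y ()   | yes _ | yes _
    vertexAt-ends x y ()   | no _  | _

    vertexAt-complete : ∀ (u : ShiftV N) → proj₁ u ≢ proj₁ v → ∃[ w ] vertexAt (tail u) (head u) ≡ just w
    vertexAt-complete ((x , y) , edge) ≢v
      with 1 ≤? x ×-dec x <? y ×-dec y ≤? N | Product.≡-dec _≟_ _≟_ (x , y) (proj₁ v)
    ... | yes _     | no _ = _ , refl
    ... | yes _     | yes ≡v = contradiction ≡v ≢v
    ... | no ¬edge  | _    = contradiction edge ¬edge

    Hits : ℕ → Pred (Fin k) _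
    Hits x i = ∃[ y ] AnyMaybe (λ w → c w ≡ i) (vertexAt x (toℕ {suc N} y))

    hits? : ∀ x → Decidable (Hits x)
    hits? x i = any? λ y → MaybeAny.dec (λ w → c w Fin.≟ i) (vertexAt x (toℕ y))

    colours : ℕ → Subset k
    colours x = comprehension (hits? x)

    ∈-colours⁺ : ∀ {x y w} → y ≤ N → vertexAt x y ≡ just w → c w ∈ₛ colours x
    ∈-colours⁺ {x} y≤N at≡ = ∈-comprehension⁺ (hits? x) (fromℕ< (s≤s y≤N) ,
      subst (λ y → AnyMaybe _ (vertexAt x y)) (sym (toℕ-fromℕ< (s≤s y≤N)))
        (subst (AnyMaybe _) (sym at≡) (MaybeAny.just refl)))

    ∈-colours⁻ : ∀ {x i} → i ∈ₛ colours x → ∃₂ λ y w → vertexAt x y ≡ just w × c w ≡ i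
    ∈-colours⁻ {x} i∈ with y , hit ← ∈-comprehension⁻ (hits? x) i∈ = toℕ y , just-of hit
      where
      just-of : ∀ {P : Pred (V (ShiftGraph N ─ v)) _} {m} → AnyMaybe P m → ∃[ w ] m ≡ just w × P w
      just-of (MaybeAny.just Pw) = _ , refl , Pw

    separates : SeparatesAllBut colours v
    separates u ≢v colours⊆ with w , at≡ ← vertexAt-complete u ≢v
      with _ , w′ , at′≡ , same ← ∈-colours⁻ (colours⊆ (∈-colours⁺ (proj₂ (proj₂ (proj₂ u))) at≡))
      = proper w w′ (inj₁ (trans (cong proj₂ (vertexAt-ends _ _ at≡))
                                 (sym (cong proj₁ (vertexAt-ends _ _ at′≡)))))
          (sym same)

ends-injective : ∀ {N} {u w : ShiftV N} → proj₁ u ≡ proj₁ w → u ≡ w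
ends-injective {u = _ , 1≤x , x<y , y≤N} {_ , 1≤x′ , x<y′ , y≤N′} refl
  rewrite ≤-irrelevant 1≤x 1≤x′ | ≤-irrelevant x<y x<y′ | ≤-irrelevant y≤N y≤N′ = refl

shift-colourable : ∀ {N} m → N ≤ 2 ^ m → Colourable (ShiftGraph N) m
shift-colourable {N} m N≤2^m = separating⇒colourable (ShiftGraph N) (λ u → u) (λ _ _ uw → uw)
  (λ x → subsets m ‼ (x ∸ 1))
  (λ ((x , y) , 1≤x , x<y , y≤N) → AllPairs-‼ (subsets-sorted m) (∸-monoˡ-< x<y 1≤x)
    (subst (y ∸ 1 <_) (sym (length-subsets m))
      (<-≤-trans (∸-monoʳ-< (s≤s z≤n) (≤-trans 1≤x (<⇒≤ x<y))) (≤-trans y≤N N≤2^m))))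

module Necessity {n : ℕ} (v : ShiftV (2 ^ n + 1)) (S : ℕ → Subset n) (separates : SeparatesAllBut S v) where

  private
    N a b : ℕ
    N = 2 ^ n + 1
    a = tail v
    b = head v
    1≤a : 1 ≤ a
    1≤a = proj₁ (proj₂ v)
    a<b : a < b
    a<b = proj₁ (proj₂ (proj₂ v))
    b≤N : b ≤ N
    b≤N = proj₂ (proj₂ (proj₂ v))

  distinct : ∀ {x y} → 1 ≤ x → x < y → y ≤ N → (x , y) ≢ (a , b) → S x ≢ S y
  distinct 1≤x x<y y≤N ≢ab Sx≡Sy = separates ((_ , _) , 1≤x , x<y , y≤N) ≢ab (⊆-reflexive Sx≡Sy)

  S[a]≡S[b] : S a ≡ S b
  S[a]≡S[b] with Vec.≡-dec Bool._≟_ (S a) (S b)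
  ... | yes eq = eq
  ... | no  S[a]≢S[b] = contradiction
    (subst (N ≤_) (length-subsets n) (interval-pigeonhole S 1 N injective (λ _ _ → ∈-subsets _)))
    (m+1+n≰m (2 ^ n))
    where
    injective : ∀ {x y} → 1 ≤ x → x < y → y < 1 + N → S x ≢ S y
    injective {x} {y} 1≤x x<y y<1+N with Product.≡-dec _≟_ _≟_ (x , y) (a , b)
    ... | yes refl = S[a]≢S[b]
    ... | no  ≢ab  = distinct 1≤x x<y (s≤s⁻¹ y<1+N) ≢ab

  T : Subset n
  T = S a

  2^[n∸∣T∣]≤a : 2 ^ (n ∸ ∣ T ∣) ≤ a
  2^[n∸∣T∣]≤a = arithmetic (interval-pigeonhole S (suc a) (N ∸ a) injective into)
    (trans (cong (_+ count (∁? (T ⊆?_))) (sym (count-⊇ T))) (count-∁ (T ⊆?_)))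
    where
    a+[N∸a]≡N : a + (N ∸ a) ≡ N
    a+[N∸a]≡N = m+[n∸m]≡n (≤-trans (<⇒≤ a<b) b≤N)
    injective : ∀ {x y} → suc a ≤ x → x < y → y < suc a + (N ∸ a) → S x ≢ S y
    injective {y = y} a<x x<y y< = distinct (≤-trans (s≤s z≤n) a<x) x<y
      (s≤s⁻¹ (subst (y <_) (cong suc a+[N∸a]≡N) y<)) (λ eq → <-irrefl (sym (cong proj₁ eq)) a<x)
    into : ∀ {x} → suc a ≤ x → x < suc a + (N ∸ a) → S x ∈ T ∷ filter (∁? (T ⊆?_)) (subsets n)
    into {x} a<x x< with x ≟ b
    ... | yes refl = here (sym S[a]≡S[b])
    ... | no  x≢b  = there (∈-filter⁺ (∁? (T ⊆?_)) (∈-subsets (S x))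
      (separates ((_ , _) , 1≤a , a<x , s≤s⁻¹ (subst (x <_) (cong suc a+[N∸a]≡N) x<)) (x≢b ∘ cong proj₂)))
    arithmetic : ∀ {M c d} → M + 1 ∸ a ≤ suc c → d + c ≡ M → d ≤ a
    arithmetic {M} {c} {d} bound total = +-cancelʳ-≤ c d a (+-cancelʳ-≤ 1 (d + c) (a + c) (begin
      d + c + 1        ≡⟨ cong (_+ 1) total ⟩
      M + 1            ≤⟨ m≤n+m∸n (M + 1) a ⟩
      a + (M + 1 ∸ a)  ≤⟨ +-monoʳ-≤ a bound ⟩
      a + suc c        ≡⟨ +-suc a c ⟩
      suc (a + c)      ≡⟨ +-comm 1 (a + c) ⟩
      a + c + 1        ∎))
      where open ≤-Reasoning

  b≤2^n∸2^∣T∣+2 : b ≤ (2 ^ n ∸ 2 ^ ∣ T ∣) + 2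
  b≤2^n∸2^∣T∣+2 = arithmetic (interval-pigeonhole S 1 (b ∸ 1) injective into)
    (trans (cong (_+ count (∁? (_⊆? T))) (sym (count-⊆ T))) (count-∁ (_⊆? T)))
    where
    1+[b∸1]≡b : 1 + (b ∸ 1) ≡ b
    1+[b∸1]≡b = m+[n∸m]≡n (≤-trans 1≤a (<⇒≤ a<b))
    injective : ∀ {x y} → 1 ≤ x → x < y → y < 1 + (b ∸ 1) → S x ≢ S y
    injective {y = y} 1≤x x<y y< =
      distinct 1≤x x<y (≤-trans (<⇒≤ y<b) b≤N) (λ eq → <-irrefl (cong proj₂ eq) y<b)
      where
      y<b : y < b
      y<b = subst (y <_) 1+[b∸1]≡b y<
    into : ∀ {x} → 1 ≤ x → x < 1 + (b ∸ 1) → S x ∈ T ∷ filter (∁? (_⊆? T)) (subsets n)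
    into {x} 1≤x x< with x ≟ a
    ... | yes refl = here refl
    ... | no  x≢a  = there (∈-filter⁺ (∁? (_⊆? T)) (∈-subsets (S x)) λ Sx⊆T →
      separates ((_ , _) , 1≤x , subst (x <_) 1+[b∸1]≡b x< , b≤N) (x≢a ∘ cong proj₁)
        (⊆-trans Sx⊆T (⊆-reflexive S[a]≡S[b])))
    arithmetic : ∀ {M c d} → b ∸ 1 ≤ suc c → d + c ≡ M → b ≤ (M ∸ d) + 2
    arithmetic {M} {c} {d} bound total = begin
      b            ≤⟨ m≤n+m∸n b 1 ⟩
      1 + (b ∸ 1)  ≤⟨ s≤s bound ⟩
      2 + c        ≡⟨ +-comm 2 c ⟩
      c + 2        ≡⟨ cong (_+ 2) (trans (sym (m+n∸m≡n d c)) (cong (_∸ d) total)) ⟩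
      (M ∸ d) + 2  ∎
      where open ≤-Reasoning

  inW : InW n v
  inW = ℓ , m∸n≤m n ∣ T ∣ , (2^[n∸∣T∣]≤a , ≤-trans (<⇒≤ a<b) b≤U) ,
        (≤-trans 2^[n∸∣T∣]≤a (<⇒≤ a<b) , b≤U)
    where
    ℓ : ℕ
    ℓ = n ∸ ∣ T ∣
    b≤U : b ≤ (2 ^ n ∸ 2 ^ (n ∸ ℓ)) + 2
    b≤U = subst (λ t → b ≤ (2 ^ n ∸ 2 ^ t) + 2) (sym (m∸[m∸n]≡n (∣p∣≤n T))) b≤2^n∸2^∣T∣+2

-- The x-th term (counting from 1) of the list obtained from L by inserting a copy of its entry at
-- index b ∸ 2 as the a-th term is L ‼ copyIndex a b x.
copyIndex : ℕ → ℕ → ℕ → ℕ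
copyIndex a b x with <-cmp x a
... | tri< _ _ _ = x ∸ 1
... | tri≈ _ _ _ = b ∸ 2
... | tri> _ _ _ = x ∸ 2

module _ {N : ℕ} (L : List (Subset k)) (sorted : AllPairs _⊈_ L) (long : N ∸ 1 ≤ length L) where

  private
    ordered : ∀ {i j} → i < j → j < N ∸ 1 → L ‼ i ⊈ L ‼ j
    ordered i<j j<N = AllPairs-‼ sorted i<j (<-≤-trans j<N long)

    ∸2<N∸1 : ∀ {m} → 2 ≤ m → m ≤ N → m ∸ 2 < N ∸ 1
    ∸2<N∸1 2≤m m≤N = <-≤-trans (∸-monoʳ-< (s≤s (s≤s z≤n)) 2≤m) (∸-monoˡ-≤ 1 m≤N)

  duplicate-separates : (v : ShiftV N) →
    (∀ {j} → tail v ∸ 1 ≤ j → j < head v ∸ 2 → L ‼ (head v ∸ 2) ⊈ L ‼ j) →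
    SeparatesAllBut (λ x → L ‼ copyIndex (tail v) (head v) x) v
  duplicate-separates ((a , b) , 1≤a , a<b , b≤N) between ((x , y) , 1≤x , x<y , y≤N) ≢ab
    with <-cmp x a | <-cmp y a
  ... | tri< x<a _ _ | tri< y<a _ _ =
    ordered (∸-monoˡ-< x<y 1≤x) (∸-monoˡ-< (<-trans y<a (<-≤-trans a<b b≤N)) (≤-trans 1≤x (<⇒≤ x<y)))
  ... | tri< x<a _ _ | tri≈ _ _ _   =
    ordered (∸-monoˡ-< (≤-<-trans x<a a<b) (s≤s 1≤x)) (∸2<N∸1 (≤-trans (s≤s 1≤a) a<b) b≤N)
  ... | tri< x<a _ _ | tri> _ _ a<y =
    ordered (∸-monoˡ-< (≤-<-trans x<a a<y) (s≤s 1≤x)) (∸2<N∸1 (≤-trans (s≤s 1≤x) x<y) y≤N)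
  ... | tri≈ _ refl _ | tri< y<a _ _ = contradiction (<-trans x<y y<a) (<-irrefl refl)
  ... | tri≈ _ refl _ | tri≈ _ refl _ = contradiction x<y (<-irrefl refl)
  ... | tri≈ _ refl _ | tri> _ _ a<y with <-cmp y b
  ...   | tri< y<b _ _  = between (∸-monoˡ-≤ 2 a<y) (∸-monoˡ-< y<b (≤-trans (s≤s 1≤x) x<y))
  ...   | tri≈ _ refl _ = contradiction refl ≢ab
  ...   | tri> _ _ b<y  =
    ordered (∸-monoˡ-< b<y (≤-trans (s≤s 1≤a) a<b)) (∸2<N∸1 (≤-trans (s≤s 1≤x) x<y) y≤N)
  duplicate-separates _ _ ((x , y) , _ , x<y , _) _ | tri> _ _ a<x | tri< y<a _ _ =
    contradiction (<-trans (<-trans a<x x<y) y<a) (<-irrefl refl)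
  duplicate-separates _ _ ((x , y) , _ , x<y , _) _ | tri> _ _ a<x | tri≈ _ refl _ =
    contradiction (<-trans a<x x<y) (<-irrefl refl)
  duplicate-separates ((a , b) , 1≤a , _) _ ((x , y) , _ , x<y , y≤N) _ | tri> _ _ a<x | tri> _ _ _ =
    ordered (∸-monoˡ-< x<y (≤-trans (s≤s 1≤a) a<x)) (∸2<N∸1 (≤-trans (s≤s 1≤a) (<-trans a<x x<y)) y≤N)

module Sufficiency {n ℓ : ℕ} (ℓ≤n : ℓ ≤ n) (v : ShiftV (2 ^ n + 1))
  (2^ℓ≤a : 2 ^ ℓ ≤ tail v) (b≤U : head v ≤ (2 ^ n ∸ 2 ^ (n ∸ ℓ)) + 2) where

  private
    a b : ℕ
    a = tail v
    b = head v
    a<b : a < b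
    a<b = proj₁ (proj₂ (proj₂ v))

  T : Subset n
  T = firsts (n ∸ ℓ) n

  ∣T∣≡n∸ℓ : ∣ T ∣ ≡ n ∸ ℓ
  ∣T∣≡n∸ℓ = ∣firsts∣ (m∸n≤m n ℓ)

  Above Beside Below : Pred (Subset n) _
  Above  X = T ⊆ X × X ⊈ T
  Beside X = T ⊈ X × X ⊈ T
  Below  X = T ⊈ X × X ⊆ T

  Above-upward : ∀ {X Y} → Above X → X ⊆ Y → Above Y
  Above-upward (T⊆X , X⊈T) X⊆Y = ⊆-trans T⊆X X⊆Y , λ Y⊆T → X⊈T (⊆-trans X⊆Y Y⊆T)

  Below-downward : ∀ {X Y} → Below Y → X ⊆ Y → Below X
  Below-downward (T⊈Y , Y⊆T) X⊆Y = (λ T⊆X → T⊈Y (⊆-trans T⊆X X⊆Y)) , ⊆-trans X⊆Y Y⊆T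

  above? : Decidable Above
  above? X = T ⊆? X ×-dec ¬? (X ⊆? T)
  beside? : Decidable Beside
  beside? X = ¬? (T ⊆? X) ×-dec ¬? (X ⊆? T)
  below? : Decidable Below
  below? X = ¬? (T ⊆? X) ×-dec X ⊆? T

  above beside below : List (Subset n)
  above  = filter above? (subsets n)
  beside = filter beside? (subsets n)
  below  = filter below? (subsets n)

  all-above : All Above above
  all-above = All.all-filter above? (subsets n)
  all-beside : All Beside beside
  all-beside = All.all-filter beside? (subsets n)
  all-below : All Below below
  all-below = All.all-filter below? (subsets n)

  -- Chosen so that T sits at index b ∸ 2 of L, with only subsets incomparable to T at the
  -- indices a ∸ 1, …, b ∸ 3.
  cut : ℕ
  cut = b ∸ 2 ∸ length above

  middle : List (Subset n)
  middle = take cut beside ++ T ∷ drop cut beside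

  L : List (Subset n)
  L = above ++ middle ++ below

  middle-sorted : AllPairs _⊈_ middle
  middle-sorted = AllPairs-insert (take cut beside)
    (subst (AllPairs _⊈_) (sym (take++drop≡id cut beside)) (filter-subsets-sorted _))
    (All.map proj₂ (All.take⁺ cut all-beside)) (All.map proj₁ (All.drop⁺ cut all-beside))

  middle-neither : All (λ X → ¬ Above X × ¬ Below X) middle
  middle-neither = All.++⁺ (All.map neither (All.take⁺ cut all-beside))
    (((λ (_ , T⊈T) → T⊈T ⊆-refl) , (λ (T⊈T , _) → T⊈T ⊆-refl)) ∷
     All.map neither (All.drop⁺ cut all-beside))
    where
    neither : ∀ {X} → Beside X → ¬ Above X × ¬ Below X
    neither (T⊈X , X⊈T) = (λ (T⊆X , _) → T⊈X T⊆X) , (λ (_ , X⊆T) → X⊈T X⊆T)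

  L-sorted : AllPairs _⊈_ L
  L-sorted = AllPairs.++⁺ (filter-subsets-sorted _)
    (AllPairs.++⁺ middle-sorted (filter-subsets-sorted _) middle⊈below) above⊈rest
    where
    ¬Below⊈Below : ∀ {X Y} → ¬ Above X × ¬ Below X → Below Y → X ⊈ Y
    ¬Below⊈Below (_ , ¬BelowX) BelowY X⊆Y = ¬BelowX (Below-downward BelowY X⊆Y)
    Above⊈¬Above : ∀ {X Y} → Above X → ¬ Above Y → X ⊈ Y
    Above⊈¬Above AboveX ¬AboveY X⊆Y = ¬AboveY (Above-upward AboveX X⊆Y)
    middle⊈below : All (λ X → All (X ⊈_) below) middle
    middle⊈below = All.map (λ neither → All.map (¬Below⊈Below neither) all-below) middle-neither
    above⊈rest : All (λ X → All (X ⊈_) (middle ++ below)) above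
    above⊈rest = All.map (λ AboveX → All.map (Above⊈¬Above AboveX)
      (All.++⁺ (All.map proj₁ middle-neither) (All.map (λ (T⊈Y , _) (T⊆Y , _) → T⊈Y T⊆Y) all-below))) all-above

  n∸∣T∣≡ℓ : n ∸ ∣ T ∣ ≡ ℓ
  n∸∣T∣≡ℓ = trans (cong (n ∸_) ∣T∣≡n∸ℓ) (m∸[m∸n]≡n ℓ≤n)

  above<2^ℓ : length above < 2 ^ ℓ
  above<2^ℓ = subst₂ _≤_ (trans (length-++ above) (+-comm _ 1))
    (trans (count-⊇ T) (cong (2 ^_) n∸∣T∣≡ℓ))
    (sorted-length≤count (T ⊆?_) {above ++ T ∷ []}
      (AllPairs.++⁺ (filter-subsets-sorted _) ([] ∷ []) (All.map (λ (_ , X⊈T) → X⊈T ∷ []) all-above))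
      (All.++⁺ (All.map proj₁ all-above) (⊆-refl ∷ [])))

  below<2^[n∸ℓ] : length below < 2 ^ (n ∸ ℓ)
  below<2^[n∸ℓ] = subst (suc (length below) ≤_) (trans (count-⊆ T) (cong (2 ^_) ∣T∣≡n∸ℓ))
    (sorted-length≤count (_⊆? T) {T ∷ below}
      (All.map proj₁ all-below ∷ filter-subsets-sorted _) (⊆-refl ∷ All.map proj₂ all-below))

  ∈-L : ∀ X → X ∈ L
  ∈-L X with T ⊆? X | X ⊆? T
  ... | yes T⊆X | yes X⊆T = ∈-++⁺ʳ above (∈-++⁺ˡ (∈-++⁺ʳ (take cut beside) (here (⊆-antisym X⊆T T⊆X))))
  ... | yes T⊆X | no  X⊈T = ∈-++⁺ˡ (∈-filter⁺ above? (∈-subsets X) (T⊆X , X⊈T))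
  ... | no  T⊈X | yes X⊆T = ∈-++⁺ʳ above (∈-++⁺ʳ middle (∈-filter⁺ below? (∈-subsets X) (T⊈X , X⊆T)))
  ... | no  T⊈X | no  X⊈T with ∈-++⁻ (take cut beside) (subst (X ∈_) (sym (take++drop≡id cut beside))
                                                           (∈-filter⁺ beside? (∈-subsets X) (T⊈X , X⊈T)))
  ...   | inj₁ X∈before = ∈-++⁺ʳ above (∈-++⁺ˡ (∈-++⁺ˡ X∈before))
  ...   | inj₂ X∈after  = ∈-++⁺ʳ above (∈-++⁺ˡ (∈-++⁺ʳ (take cut beside) (there X∈after)))

  2^n≤L : 2 ^ n ≤ length L
  2^n≤L = subst (_≤ length L) (length-subsets n)
    (Unique-⊆⇒length≤ (sorted⇒unique (subsets-sorted n)) (λ {X} _ → ∈-L X))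

  length-middle : length middle ≡ suc (length beside)
  length-middle = begin
    length (take cut beside ++ T ∷ drop cut beside)
      ≡⟨ length-++ (take cut beside) ⟩
    length (take cut beside) + suc (length (drop cut beside))
      ≡⟨ +-suc _ _ ⟩
    suc (length (take cut beside) + length (drop cut beside))
      ≡⟨ cong suc (length-++ (take cut beside)) ⟨
    suc (length (take cut beside ++ drop cut beside))
      ≡⟨ cong (suc ∘ length) (take++drop≡id cut beside) ⟩
    suc (length beside) ∎
    where open ≡-Reasoning

  above≤b∸2 : length above ≤ b ∸ 2
  above≤b∸2 = m+n≤o⇒m≤o∸n (length above)
    (subst (_≤ b) (+-comm 2 (length above)) (≤-trans (s≤s (<-≤-trans above<2^ℓ 2^ℓ≤a)) a<b))

  cut≤beside : cut ≤ length beside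
  cut≤beside = m≤n+o⇒m∸n≤o (b ∸ 2) (length above) (begin
    b ∸ 2                                   ≤⟨ m≤n+o⇒m∸n≤o b 2 (subst (b ≤_) (+-comm _ 2) b≤U) ⟩
    2 ^ n ∸ 2 ^ (n ∸ ℓ)                     ≤⟨ m≤n+o⇒m∸n≤o (2 ^ n) (2 ^ (n ∸ ℓ)) 2^n≤ ⟩
    length above + length beside            ∎)
    where
    open ≤-Reasoning
    rearrange : ∀ x y z → x + (suc y + z) ≡ suc z + (x + y)
    rearrange = solve-∀
    2^n≤ : 2 ^ n ≤ 2 ^ (n ∸ ℓ) + (length above + length beside)
    2^n≤ = begin
      2 ^ n
        ≤⟨ 2^n≤L ⟩
      length (above ++ middle ++ below)
        ≡⟨ length-++ above ⟩
      length above + length (middle ++ below)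
        ≡⟨ cong (length above +_) (length-++ middle) ⟩
      length above + (length middle + length below)
        ≡⟨ cong (λ m → length above + (m + length below)) length-middle ⟩
      length above + (suc (length beside) + length below)
        ≡⟨ rearrange (length above) (length beside) (length below) ⟩
      suc (length below) + (length above + length beside)
        ≤⟨ +-monoˡ-≤ _ below<2^[n∸ℓ] ⟩
      2 ^ (n ∸ ℓ) + (length above + length beside) ∎

  length-before : length (take cut beside) ≡ cut
  length-before = trans (length-take cut beside) (m≤n⇒m⊓n≡m cut≤beside)

  L‼-middle : ∀ {i} → i ≤ cut → L ‼ (length above + i) ≡ middle ‼ i
  L‼-middle {i} i≤cut = trans (‼-++ʳ above i)
    (‼-++ˡ middle (subst (i <_) (sym length-middle) (s≤s (≤-trans i≤cut cut≤beside))))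

  L‼[b∸2]≡T : L ‼ (b ∸ 2) ≡ T
  L‼[b∸2]≡T = begin
    L ‼ (b ∸ 2)                               ≡⟨ cong (L ‼_) (m+[n∸m]≡n above≤b∸2) ⟨
    L ‼ (length above + cut)                  ≡⟨ L‼-middle ≤-refl ⟩
    middle ‼ cut                              ≡⟨ cong (middle ‼_) (trans (+-identityʳ _) length-before) ⟨
    middle ‼ (length (take cut beside) + 0)   ≡⟨ ‼-++ʳ (take cut beside) 0 ⟩
    T                                         ∎
    where open ≡-Reasoning

  T⊈between : ∀ {j} → a ∸ 1 ≤ j → j < b ∸ 2 → T ⊈ L ‼ j
  T⊈between {j} a∸1≤j j<b∸2 =
    subst (T ⊈_) (sym L‼j≡) (proj₁ (All-‼ (All.take⁺ cut all-beside) i<before))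
    where
    above≤j : length above ≤ j
    above≤j = ≤-trans
      (m+n≤o⇒m≤o∸n (length above) (subst (_≤ a) (+-comm 1 _) (<-≤-trans above<2^ℓ 2^ℓ≤a))) a∸1≤j
    i : ℕ
    i = j ∸ length above
    i<cut : i < cut
    i<cut = ∸-monoˡ-< j<b∸2 above≤j
    i<before : i < length (take cut beside)
    i<before = subst (i <_) (sym length-before) i<cut
    L‼j≡ : L ‼ j ≡ take cut beside ‼ i
    L‼j≡ = begin
      L ‼ j                     ≡⟨ cong (L ‼_) (m+[n∸m]≡n above≤j) ⟨
      L ‼ (length above + i)    ≡⟨ L‼-middle (<⇒≤ i<cut) ⟩
      middle ‼ i                ≡⟨ ‼-++ˡ (take cut beside) i<before ⟩
      take cut beside ‼ i       ∎
      where open ≡-Reasoning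

  separating : SeparatesAllBut (λ x → L ‼ copyIndex a b x) v
  separating = duplicate-separates L L-sorted (subst (_≤ length L) (sym (m+n∸n≡m (2 ^ n) 1)) 2^n≤L) v
    (λ a∸1≤j j<b∸2 → subst (_⊈ L ‼ _) (sym L‼[b∸2]≡T) (T⊈between a∸1≤j j<b∸2))

InW⇔colourable : ∀ {n} (v : ShiftV (2 ^ n + 1)) → InW n v ⇔ Colourable (ShiftGraph (2 ^ n + 1) ─ v) n
InW⇔colourable {n} v = mk⇔
  (λ (ℓ , ℓ≤n , (2^ℓ≤a , _) , (_ , b≤U)) →
    separating⇒colourable (ShiftGraph (2 ^ n + 1) ─ v) proj₁ (λ _ _ uw → uw) _
      λ u → Sufficiency.separating ℓ≤n v 2^ℓ≤a b≤U (proj₁ u) (proj₂ u ∘ ends-injective))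
  (λ colourable → let S , separates = colourable⇒separating v colourable in Necessity.inW v S separates)

shift-¬colourable : ∀ {n} → 1 ≤ n → ¬ Colourable (ShiftGraph (2 ^ n + 1)) n
shift-¬colourable {n} 1≤n colourable =
  w₀∉W (Equivalence.from (InW⇔colourable w₀) (colourable-─ w₀ colourable))
  where
  w₀ : ShiftV (2 ^ n + 1)
  w₀ = (1 , 2 ^ n + 1) , ≤-refl , +-monoˡ-≤ 1 (m^n>0 2 n) , ≤-refl
  w₀∉W : ¬ InW n w₀
  w₀∉W (zero , _ , _ , _ , N≤U) = contradiction
    (+-cancelʳ-≤ 1 (2 ^ n) 1 (subst (2 ^ n + 1 ≤_) (cong (_+ 2) (n∸n≡0 (2 ^ n))) N≤U))
    (<⇒≱ (^-monoʳ-≤ 2 1≤n))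
  w₀∉W (suc ℓ , _ , (2^[1+ℓ]≤1 , _) , _) = <⇒≱ (^-monoʳ-≤ 2 {1} {suc ℓ} (s≤s z≤n)) 2^[1+ℓ]≤1

InW? : ∀ n (v : ShiftV (2 ^ n + 1)) → Dec (InW n v)
InW? n ((x , y) , _) =
  map′ (λ (ℓ , ℓ<1+n , I) → ℓ , s≤s⁻¹ ℓ<1+n , I) (λ (ℓ , ℓ≤n , I) → ℓ , s≤s ℓ≤n , I)
    (anyUpTo? (λ ℓ → InI? ℓ x ×-dec InI? ℓ y) (suc n))
  where
  InI? : ∀ ℓ z → Dec (InI n ℓ z)
  InI? ℓ z = 2 ^ ℓ ≤? z ×-dec z ≤? (2 ^ n ∸ 2 ^ (n ∸ ℓ)) + 2

theorem3 : (n : ℕ) → 2 ≤ n → (v : ShiftV (2 ^ n + 1)) →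
    ChiLess (ShiftGraph (2 ^ n + 1) ─ v) (ShiftGraph (2 ^ n + 1)) ⇔ InW n v
theorem3 n 2≤n v = mk⇔ χ<⇒InW InW⇒χ<
  where
  G : Graph
  G = ShiftGraph (2 ^ n + 1)
  χ[G]≡1+n : IsChromaticNumber G (suc n)
  χ[G]≡1+n = chromatic (shift-¬colourable (<⇒≤ 2≤n))
    (shift-colourable (suc n) (+-monoʳ-≤ (2 ^ n) (≤-trans (m^n>0 2 n) (m≤m+n (2 ^ n) 0))))
  χ<⇒InW : ChiLess (G ─ v) G → InW n v
  χ<⇒InW χ< with InW? n v
  ... | yes inW = inW
  ... | no  ∉W  = contradiction (χ< _ _ χ[G]≡1+n (chromatic (∉W ∘ Equivalence.from (InW⇔colourable v))
                                                            (colourable-─ v (proj₁ χ[G]≡1+n))))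
                                (<-irrefl refl)
  InW⇒χ< : InW n v → ChiLess (G ─ v) G
  InW⇒χ< inW _ _ (colourable-G , _) (_ , minimal-G─v) =
    ≤-trans (s≤s (minimal-G─v n (Equivalence.to (InW⇔colourable v) inW))) (proj₂ χ[G]≡1+n _ colourable-G)
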